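{- For all states $x,y$ of the LTS, $[\![\{x\}]\!]_{2} \sqsubseteq' [\![\{y\}]\!]_{2}$ iff $y\sqsubseteq_{must} x$.
   Context: Consider an LTS with state set $S$ over $A\cup\{\tau\}$; $\xRightarrow{a}$ is $\xrightarrow{\tau}^*\xrightarrow{a}\xrightarrow{\tau}^*$ (extended to words). $x$ diverges ($x\not\downarrow$) if it can perform infinitely many $\tau$-steps; $x\downarrow\varepsilon$ iff $x$ does not diverge, $x\downarrow aw$ iff $x\downarrow\varepsilon$ and $x'\downarrow w$ for all $x'$ with $x\xRightarrow{a}x'$. Acceptance sets: $A(x,w)=\{\{a\mid x'\xrightarrow{a}\}\mid x\xRightarrow{w}x',\ x'\not\xrightarrow{\tau}\}$. For $B,C\subseteq\mathcal{P}(A)$, $B\subset\subset C$ iff every $B_i\in B$ contains some $C_i\in C$. $x\sqsubseteq_{must}y$ iff for all $w$, $x\downarrow w$ implies $y\downarrow w$ and $A(y,w)\subset\subset A(x,w)$. For $\mathcal{X}\subseteq\mathcal{P}(A)$ let $min(\mathcal{X})$ be its inclusion-minimal elements (an antichain). Define $t\colon S\to(1+\mathcal{P}_\omega S)^A$, $1=\{\top\}$, by $t(x)(a)=\top$ if $x\not\downarrow a$, else $\{y\mid x\xRightarrow{a}y\}$, with $t^\sharp(\top)(a)=\top$, $t^\sharp(X)(a)=\bigsqcup_{x\in X}t(x)(a)$ (union, absorbing $\top$). Define $o_2(x)=\top$ if $x\not\downarrow$, otherwise $o_2(x)=min(\{\{a\mid x'\xrightarrow{a}\}\mid x\xrightarrow{\tau}^*x',\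 x'\not\xrightarrow{\tau}\})$; $o_2^\sharp(\top)=\top$, $o_2^\sharp(\emptyset)=\emptyset$, and for nonempty $X\subseteq S$, $o_2^\sharp(X)=\top$ if some $o_2(x)=\top$ with $x\in X$, otherwise $min(\bigcup_{x\in X}o_2(x))$. Then $[\![-]\!]_2\colon 1+\mathcal{P}_\omega S\to(1+\mathcal{A})^{A^*}$, with $\mathcal{A}$ the antichains of $\mathcal{P}(A)$, is $[\![X]\!]_2(\varepsilon)=o_2^\sharp(X)$, $[\![X]\!]_2(aw)=[\![t^\sharp(X)(a)]\!]_2(w)$. The order $\sqsubseteq'$ on $(1+\mathcal{A})^{A^*}$: $\phi\sqsubseteq'\psi$ iff for all $w\in A^*$, if $\phi(w)=\top$ then $\psi(w)=\top$, and if $\phi(w)\neq\top$ then $\psi(w)=\top$ or $\phi(w)\subset\subset\psi(w)$. -}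

module Defs where

import Level
open import Level using (0ℓ; Lift)
open import Data.Nat using (ℕ; suc)
open import Data.Unit using (⊤; tt)
open import Data.Empty using (⊥)
open import Data.Maybe using (Maybe; just; nothing)
open import Data.List using (List; []; _∷_)
open import Data.List.Membership.Propositional using (_∈_)
open import Data.Product using (Σ; ∃; ∃-syntax; _×_; _,_)
open import Data.Sum using (_⊎_; inj₁; inj₂)
open import Relation.Nullary using (¬_; yes; no)
open import Relation.Binary.PropositionalEquality using (_≡_)
open import Relation.Binary.Construct.Closure.ReflexiveTransitive using (Star)
open import Axiom.ExcludedMiddle using (ExcludedMiddle)

-- A labelled transition system over A ∪ {τ}; the label τ is 'nothing'.
record LTS : Set₁ where
  field
    S    : Set
    A    : Set
    step : S → Maybe A → S → Set

-- Finitely branching: every state has finitely many outgoing transitions.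
-- (This is the implicit hypothesis under which t lands in P_ω S.)
FinitelyBranching : LTS → Set
FinitelyBranching L =
  ∀ x → ∃[ l ] (∀ μ y → step x μ y → (μ , y) ∈ l)
  where open LTS L

-- Everything below is parametrised by excluded middle (the paper's
-- definitions of t and o₂ branch on undecidable properties such as divergence)
-- and by the LTS.
module Semantics (em : ExcludedMiddle 0ℓ) (L : LTS) where
  open LTS L

  Sub : Set → Set₁
  Sub X = X → Set

  _⊆_ : Sub A → Sub A → Set
  B ⊆ C = ∀ a → B a → C a

  _≐_ : Sub A → Sub A → Set
  B ≐ C = (B ⊆ C) × (C ⊆ B)

  -- families of subsets of A (antichains arise as outputs of min)
  Fam : Set₂
  Fam = Sub A → Set₁

  _⊂⊂_ : Fam → Fam → Set₁
  B ⊂⊂ C = ∀ Bi → B Bi → ∃[ Ci ] (C Ci × (Ci ⊆ Bi))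

  min : Fam → Fam
  min 𝒳 B = 𝒳 B × (∀ C → 𝒳 C → C ⊆ B → B ⊆ C)

  _-τ→_ : S → S → Set
  x -τ→ y = step x nothing y

  _-τ*→_ : S → S → Set
  _-τ*→_ = Star _-τ→_

  _=[_]⇒_ : S → A → S → Set
  x =[ a ]⇒ y = ∃[ u ] ∃[ v ] ((x -τ*→ u) × step u (just a) v × (v -τ*→ y))

  _=[_]⇒*_ : S → List A → S → Set
  x =[ [] ]⇒* y = x -τ*→ y
  x =[ a ∷ w ]⇒* y = ∃[ z ] ((x =[ a ]⇒ z) × (z =[ w ]⇒* y))

  Stable : S → Set
  Stable x = ∀ y → ¬ (x -τ→ y)

  enabled : S → Sub A
  enabled x a = ∃[ y ] step x (just a) y

  Diverges : S → Set
  Diverges x = Σ (ℕ → S) λ f → ((f 0 ≡ x) × (∀ i → f i -τ→ f (suc i)))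

  _↓_ : S → List A → Set
  x ↓ [] = ¬ Diverges x
  x ↓ (a ∷ w) = (x ↓ []) × (∀ x' → x =[ a ]⇒ x' → x' ↓ w)

  Acc : S → List A → Fam
  Acc x w B = Lift (Level.suc 0ℓ) (∃[ x' ] ((x =[ w ]⇒* x') × Stable x' × (B ≐ enabled x')))

  _⊑must_ : S → S → Set₁
  x ⊑must y = ∀ w → x ↓ w → (y ↓ w) × (Acc y w ⊂⊂ Acc x w)

  -- 1 + P S  (inj₁ tt is ⊤)
  V : Set₁
  V = ⊤ ⊎ Sub S

  O : Set₂
  O = ⊤ ⊎ Fam

  IsTopV : V → Set
  IsTopV (inj₁ _) = ⊤
  IsTopV (inj₂ _) = ⊥

  MemV : V → Sub S
  MemV (inj₁ _) _ = ⊥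
  MemV (inj₂ Y) y = Y y

  IsTopO : O → Set
  IsTopO (inj₁ _) = ⊤
  IsTopO (inj₂ _) = ⊥

  MemO : O → Fam
  MemO (inj₁ _) _ = Lift (Level.suc 0ℓ) ⊥
  MemO (inj₂ 𝒳) B = 𝒳 B

  t : S → A → V
  t x a with em {x ↓ (a ∷ [])}
  ... | no  _ = inj₁ tt
  ... | yes _ = inj₂ (λ y → x =[ a ]⇒ y)

  t♯ : V → A → V
  t♯ (inj₁ _) a = inj₁ tt
  t♯ (inj₂ X) a with em {∃[ x ] (X x × IsTopV (t x a))}
  ... | yes _ = inj₁ tt
  ... | no  _ = inj₂ (λ y → ∃[ x ] (X x × MemV (t x a) y))

  o₂ : S → O
  o₂ x with em {Diverges x}
  ... | yes _ = inj₁ tt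
  ... | no  _ = inj₂ (min (λ B → Lift (Level.suc 0ℓ) (∃[ x' ] ((x -τ*→ x') × Stable x' × (B ≐ enabled x')))))

  o₂♯ : V → O
  o₂♯ (inj₁ _) = inj₁ tt
  o₂♯ (inj₂ X) with em {∃[ x ] X x}
  ... | no  _ = inj₂ (λ _ → Lift (Level.suc 0ℓ) ⊥)
  ... | yes _ with em {∃[ x ] (X x × IsTopO (o₂ x))}
  ...   | yes _ = inj₁ tt
  ...   | no  _ = inj₂ (min (λ B → ∃[ x ] (X x × MemO (o₂ x) B)))

  ⟦_⟧₂ : V → List A → O
  ⟦ X ⟧₂ [] = o₂♯ X
  ⟦ X ⟧₂ (a ∷ w) = ⟦ t♯ X a ⟧₂ w

  ｛_｝ : S → V
  ｛ x ｝ = inj₂ (λ y → y ≡ x)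

  LeO : O → O → Set₁
  LeO (inj₁ _) (inj₁ _) = Data.Unit.Polymorphic.⊤
    where import Data.Unit.Polymorphic
  LeO (inj₁ _) (inj₂ _) = Data.Empty.Polymorphic.⊥
    where import Data.Empty.Polymorphic
  LeO (inj₂ _) (inj₁ _) = Data.Unit.Polymorphic.⊤
    where import Data.Unit.Polymorphic
  LeO (inj₂ B) (inj₂ C) = B ⊂⊂ C

  _⊑′_ : (List A → O) → (List A → O) → Set₁
  φ ⊑′ ψ = ∀ w → LeO (φ w) (ψ w)

-- The heart of the proof is a description of ⟦ X ⟧₂ w for a set X of states:
--   * if some state of X does not converge on w, then ⟦ X ⟧₂ w = ⊤;
--   * if every state of X converges on w, then ⟦ X ⟧₂ w is a family F which is
--     ⊂⊂-equivalent to the union of the acceptance sets A(x,w), x ∈ X: every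
--     member of F is an acceptance set of some x ∈ X, and every acceptance set
--     of an x ∈ X contains a member of F.  In
-- the base case o₂♯ takes inclusion-minimal elements; that every acceptance
-- set contains a minimal one uses that enabled sets are finite (finite
-- branching), via a descent along a strictly shrinking list of actions.
-- For singletons the description says that ⟦ {x} ⟧₂ w is ⊤ exactly when x
-- diverges on w, and is otherwise ⊂⊂-equivalent to A(x,w); since ⊂⊂ is
-- transitive, the proposition follows by comparing the two sides pointwise.
module Submission where

open import Defs
open import Level using (0ℓ; Lift; lift; lower)
open import Axiom.ExcludedMiddle using (ExcludedMiddle)
open import Function.Bundles using (_⇔_; mk⇔)
open import Data.Nat using (_≤_; s≤s)
open import Data.Nat.Properties using (≤-refl; ≤-trans)
open import Data.Unit using (tt)
open import Data.Empty using (⊥; ⊥-elim)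
open import Data.Maybe using (just)
open import Data.Maybe.Relation.Unary.Any using (just)
open import Data.List using (List; []; _∷_; length; filter; mapMaybe)
open import Data.List.Membership.Propositional using (_∈_)
open import Data.List.Membership.Propositional.Properties using (∈-filter⁺)
open import Data.List.Properties using (filter-notAll)
import Data.List.Relation.Unary.Any as Any
open import Data.List.Relation.Unary.Any.Properties using (gmap; mapMaybe⁺)
open import Data.Product using (∃-syntax; _×_; _,_; proj₁; proj₂)
open import Data.Sum using (_⊎_; inj₁; inj₂)
open import Relation.Nullary using (¬_; yes; no)
open import Relation.Binary.PropositionalEquality using (_≡_; refl; subst; subst₂; sym; trans; cong)

module Proof (em : ExcludedMiddle 0ℓ) (L : LTS) (fb : FinitelyBranching L) where
  open LTS L
  open Semantics em L

  stable : {P : Set} → ¬ ¬ P → P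
  stable {P} ¬¬p with em {P}
  ... | yes p = p
  ... | no ¬p = ⊥-elim (¬¬p ¬p)

  -- Excluded middle as a disjunction; unlike a 'with' on em it does not
  -- abstract the em-tests inside the semantic definitions in the goal.
  decide : (P : Set) → P ⊎ ¬ P
  decide P with em {P}
  ... | yes p = inj₁ p
  ... | no ¬p = inj₂ ¬p

  ⊆-refl : {B : Sub A} → B ⊆ B
  ⊆-refl _ b = b

  ⊆-trans : {B C D : Sub A} → B ⊆ C → C ⊆ D → B ⊆ D
  ⊆-trans B⊆C C⊆D a b = C⊆D a (B⊆C a b)

  ⊂⊂-trans : {𝒳 𝒴 𝒵 : Fam} → 𝒳 ⊂⊂ 𝒴 → 𝒴 ⊂⊂ 𝒵 → 𝒳 ⊂⊂ 𝒵
  ⊂⊂-trans 𝒳⊂⊂𝒴 𝒴⊂⊂𝒵 B B∈𝒳 with 𝒳⊂⊂𝒴 B B∈𝒳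
  ... | C , C∈𝒴 , C⊆B with 𝒴⊂⊂𝒵 C C∈𝒴
  ...   | D , D∈𝒵 , D⊆C = D , D∈𝒵 , ⊆-trans D⊆C C⊆B

  Finite : Sub A → Set
  Finite B = ∃[ l ] (∀ a → B a → a ∈ l)

  -- Finite branching makes every enabled set finite: the labels of the
  -- outgoing transitions cover it.
  enabled-finite : ∀ s → Finite (enabled s)
  enabled-finite s with fb s
  ... | edges , covers =
    mapMaybe proj₁ edges ,
    λ a (y , s-a→y) → mapMaybe⁺ proj₁ edges (gmap (λ { refl → just refl }) (covers (just a) y s-a→y))

  Minimal : {I : Set} → (I → Sub A) → (I → Set) → I → Set
  Minimal f R j = ∀ k → R k → f k ⊆ f j → f j ⊆ f k

  -- If i is
  -- not minimal, some R-index k has f k ⊊ f i; then f k is covered by the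
  -- strictly shorter list of those actions of the cover that lie in f k.
  minimal-below : {I : Set} (f : I → Sub A) (R : I → Set) →
                  ∀ i → R i → Finite (f i) → ∃[ j ] (R j × Minimal f R j × f j ⊆ f i)
  minimal-below f R i Ri (l , covers) = descend (length l) l ≤-refl i Ri covers
    where
      descend : ∀ n l → length l ≤ n → ∀ i → R i → (∀ a → f i a → a ∈ l) →
                ∃[ j ] (R j × Minimal f R j × f j ⊆ f i)
      descend n l len i Ri covers with em {∃[ k ] (R k × f k ⊆ f i × ∃[ a ] (f i a × ¬ f k a))}
      ... | no no-smaller =
        i , Ri , (λ k Rk k⊆i a a∈i → stable λ a∉k → no-smaller (k , Rk , k⊆i , a , a∈i , a∉k)) , ⊆-refl
      ... | yes (k , Rk , k⊆i , a , a∈i , a∉k)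
        with ≤-trans (filter-notAll (λ _ → em) l (Any.map (λ { refl → a∉k }) (covers a a∈i))) len
      ...   | s≤s shorter
        with descend _ _ shorter k Rk (λ b b∈k → ∈-filter⁺ (λ _ → em) (covers b (k⊆i b b∈k)) b∈k)
      ...     | j , Rj , minimal , j⊆k = j , Rj , minimal , ⊆-trans j⊆k k⊆i

  t-converging : ∀ {x a} → x ↓ (a ∷ []) → t x a ≡ inj₂ (λ y → x =[ a ]⇒ y)
  t-converging {x} {a} c with em {x ↓ (a ∷ [])}
  ... | yes _ = refl
  ... | no ¬c = ⊥-elim (¬c c)

  t-diverging : ∀ {x a} → ¬ x ↓ (a ∷ []) → t x a ≡ inj₁ tt
  t-diverging {x} {a} ¬c with em {x ↓ (a ∷ [])}
  ... | yes c = ⊥-elim (¬c c)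
  ... | no _ = refl

  HitsTop : Sub S → A → Set
  HitsTop X a = ∃[ x ] (X x × IsTopV (t x a))

  Successors : Sub S → A → Sub S
  Successors X a y = ∃[ x ] (X x × MemV (t x a) y)

  t♯-top : ∀ X a → HitsTop X a → t♯ (inj₂ X) a ≡ inj₁ tt
  t♯-top X a top with em {HitsTop X a}
  ... | yes _ = refl
  ... | no ¬top = ⊥-elim (¬top top)

  t♯-set : ∀ X a → ¬ HitsTop X a → t♯ (inj₂ X) a ≡ inj₂ (Successors X a)
  t♯-set X a ¬top with em {HitsTop X a}
  ... | yes top = ⊥-elim (¬top top)
  ... | no _ = refl

  o₂-diverging : ∀ {x} → Diverges x → o₂ x ≡ inj₁ tt
  o₂-diverging {x} d with em {Diverges x}
  ... | yes _ = refl
  ... | no ¬d = ⊥-elim (¬d d)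

  o₂-converging : ∀ {x} → ¬ Diverges x → o₂ x ≡ inj₂ (min (Acc x []))
  o₂-converging {x} ¬d with em {Diverges x}
  ... | yes d = ⊥-elim (¬d d)
  ... | no _ = refl

  ObservesTop : Sub S → Set
  ObservesTop X = ∃[ x ] (X x × IsTopO (o₂ x))

  Observations : Sub S → Fam
  Observations X B = ∃[ x ] (X x × MemO (o₂ x) B)

  o₂♯-empty : ∀ X → ¬ (∃[ x ] X x) → o₂♯ (inj₂ X) ≡ inj₂ (λ _ → Lift _ ⊥)
  o₂♯-empty X empty with em {∃[ x ] X x}
  ... | yes inhabited = ⊥-elim (empty inhabited)
  ... | no _ = refl

  o₂♯-top : ∀ X → ObservesTop X → o₂♯ (inj₂ X) ≡ inj₁ tt
  o₂♯-top X top@(x , Xx , _) with em {∃[ x ] X x}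
  ... | no empty = ⊥-elim (empty (x , Xx))
  ... | yes _ with em {ObservesTop X}
  ...   | yes _ = refl
  ...   | no ¬top = ⊥-elim (¬top top)

  o₂♯-set : ∀ X → ∃[ x ] X x → ¬ ObservesTop X → o₂♯ (inj₂ X) ≡ inj₂ (min (Observations X))
  o₂♯-set X inhabited ¬top with em {∃[ x ] X x}
  ... | no empty = ⊥-elim (empty inhabited)
  ... | yes _ with em {ObservesTop X}
  ...   | yes top = ⊥-elim (¬top top)
  ...   | no _ = refl

  top-absorbing : ∀ w → ⟦ inj₁ tt ⟧₂ w ≡ inj₁ tt
  top-absorbing [] = refl
  top-absorbing (a ∷ w) = top-absorbing w

  -- On a letter
  -- a either t♯ already yields ⊤, or x converges on a and one of its
  -- a-successors, which t♯ keeps, fails to converge on the rest of w.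
  divergent-top : ∀ w X x → X x → ¬ x ↓ w → ⟦ inj₂ X ⟧₂ w ≡ inj₁ tt
  divergent-top [] X x Xx ¬c = o₂♯-top X (x , Xx , subst IsTopO (sym (o₂-diverging (stable ¬c))) tt)
  divergent-top (a ∷ w) X x Xx ¬c with decide (HitsTop X a)
  ... | inj₁ top = trans (cong (λ v → ⟦ v ⟧₂ w) (t♯-top X a top)) (top-absorbing w)
  ... | inj₂ ¬top =
    trans (cong (λ v → ⟦ v ⟧₂ w) (t♯-set X a ¬top))
          (divergent-top w (Successors X a) x' (x , Xx , subst (λ v → MemV v x') (sym (t-converging c-a)) x⇒x') ¬c')
    where
      c-a : x ↓ (a ∷ [])
      c-a = stable λ ¬c-a → ¬top (x , Xx , subst IsTopV (sym (t-diverging ¬c-a)) tt)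
      witness : ∃[ x' ] ((x =[ a ]⇒ x') × ¬ x' ↓ w)
      witness = stable λ none → ¬c (proj₁ c-a , λ x' x⇒x' → stable λ ¬c' → none (x' , x⇒x' , ¬c'))
      x' = proj₁ witness
      x⇒x' = proj₁ (proj₂ witness)
      ¬c' = proj₂ (proj₂ witness)

  converges-now : ∀ {x} w → x ↓ w → x ↓ []
  converges-now [] c = c
  converges-now (a ∷ w) c = proj₁ c

  Converges : Sub S → List A → Set
  Converges X w = ∀ x → X x → x ↓ w

  record Denotation (X : Sub S) (w : List A) : Set₂ where
    field
      family   : Fam
      computes : ⟦ inj₂ X ⟧₂ w ≡ inj₂ family
      sound    : ∀ B → family B → ∃[ x ] (X x × Acc x w B)
      complete : ∀ x B → X x → Acc x w B → ∃[ C ] (family C × C ⊆ B)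
  open Denotation

  -- Base case for inhabited X: o₂♯ X = min of the union of the min (A(x,ε)).
  -- A stable state s' reachable from X whose enabled set is minimal among all
  -- such states gives a member of that family below a given acceptance set.
  observation-denotation : ∀ X → Converges X [] → ∃[ x ] X x → Denotation X []
  observation-denotation X conv inhabited = record
    { family = min (Observations X)
    ; computes = o₂♯-set X inhabited ¬top
    ; sound = λ B min-B → let (x , Xx , min-Acc) = local (proj₁ min-B) in x , Xx , proj₁ min-Acc
    ; complete = completeness
    }
    where
      ¬top : ¬ ObservesTop X
      ¬top (x , Xx , top) = subst IsTopO (o₂-converging (conv x Xx)) top

      local : ∀ {B} → Observations X B → ∃[ x ] (X x × min (Acc x []) B)
      local {B} (x , Xx , obs) = x , Xx , subst (λ o → MemO o B) (o₂-converging (conv x Xx)) obs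

      Reach : S → Set
      Reach s = ∃[ x ] (X x × (x -τ*→ s) × Stable s)

      below-minimal : ∀ {s x D} → Minimal enabled Reach s → X x → Acc x [] D →
                      D ⊆ enabled s → enabled s ⊆ D
      below-minimal minimal Xx (lift (z , x→z , stable-z , D≐z)) D⊆s =
        ⊆-trans (minimal z (_ , Xx , x→z , stable-z) (⊆-trans (proj₂ D≐z) D⊆s)) (proj₂ D≐z)

      completeness : ∀ x B → X x → Acc x [] B → ∃[ C ] (min (Observations X) C × C ⊆ B)
      completeness x B Xx (lift (s , x→s , stable-s , B≐s))
        with minimal-below enabled Reach s (x , Xx , x→s , stable-s) (enabled-finite s)
      ... | s' , (x₀ , Xx₀ , x₀→s' , stable-s') , minimal , s'⊆s =
        enabled s' , (observed , minimal-obs) , ⊆-trans s'⊆s (proj₂ B≐s)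
        where
          minimal-at-x₀ : min (Acc x₀ []) (enabled s')
          minimal-at-x₀ = lift (s' , x₀→s' , stable-s' , ⊆-refl , ⊆-refl) ,
                          λ D acc → below-minimal minimal Xx₀ acc
          observed : Observations X (enabled s')
          observed = x₀ , Xx₀ , subst (λ o → MemO o (enabled s')) (sym (o₂-converging (conv x₀ Xx₀))) minimal-at-x₀
          minimal-obs : ∀ D → Observations X D → D ⊆ enabled s' → enabled s' ⊆ D
          minimal-obs D obs with local obs
          ... | x₁ , Xx₁ , min-D = below-minimal minimal Xx₁ (proj₁ min-D)

  -- On a letter a no member
  -- hits ⊤, so t♯ passes to the a-successors, which converge on the rest of
  -- w; acceptance sets of X after aw are those of its a-successors after w.
  denotation : ∀ w X → Converges X w → Denotation X w
  denotation [] X conv with decide (∃[ x ] X x)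
  ... | inj₁ inhabited = observation-denotation X conv inhabited
  ... | inj₂ empty = record
    { family = λ _ → Lift _ ⊥
    ; computes = o₂♯-empty X empty
    ; sound = λ _ ()
    ; complete = λ x _ Xx _ → ⊥-elim (empty (x , Xx))
    }
  denotation (a ∷ w) X conv = record
    { family = family next
    ; computes = trans (cong (λ v → ⟦ v ⟧₂ w) (t♯-set X a ¬top)) (computes next)
    ; sound = soundness
    ; complete = λ { x B Xx (lift (s , (y , x⇒y , y⇒s) , st , e)) →
                     complete next y B (into Xx x⇒y) (lift (s , y⇒s , st , e)) }
    }
    where
      conv-a : ∀ {x} → X x → x ↓ (a ∷ [])
      conv-a Xx = proj₁ (conv _ Xx) , λ x' x⇒x' → converges-now w (proj₂ (conv _ Xx) x' x⇒x')

      ¬top : ¬ HitsTop X a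
      ¬top (x , Xx , top) = subst IsTopV (t-converging (conv-a Xx)) top

      out : ∀ {y} → Successors X a y → ∃[ x ] (X x × (x =[ a ]⇒ y))
      out {y} (x , Xx , m) = x , Xx , subst (λ v → MemV v y) (t-converging (conv-a Xx)) m

      into : ∀ {x y} → X x → x =[ a ]⇒ y → Successors X a y
      into {x} {y} Xx x⇒y = x , Xx , subst (λ v → MemV v y) (sym (t-converging (conv-a Xx))) x⇒y

      next : Denotation (Successors X a) w
      next = denotation w (Successors X a) λ y succ →
        let (x , Xx , x⇒y) = out succ in proj₂ (conv x Xx) y x⇒y

      soundness : ∀ B → family next B → ∃[ x ] (X x × Acc x (a ∷ w) B)
      soundness B B∈next with sound next B B∈next
      ... | y , succ , lift (s , y⇒s , st , e) with out succ
      ...   | x , Xx , x⇒y = x , Xx , lift (s , (y , x⇒y , y⇒s) , st , e)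

  singleton-denotation : ∀ {x} w → x ↓ w →
    ∃[ F ] ((⟦ ｛ x ｝ ⟧₂ w ≡ inj₂ F) × (F ⊂⊂ Acc x w) × (Acc x w ⊂⊂ F))
  singleton-denotation {x} w c = family D , computes D , to-Acc , λ B → complete D x B refl
    where
      D : Denotation (λ y → y ≡ x) w
      D = denotation w (λ y → y ≡ x) λ { _ refl → c }
      to-Acc : family D ⊂⊂ Acc x w
      to-Acc B B∈D with sound D B B∈D
      ... | _ , refl , acc = B , acc , ⊆-refl

  LeO-top : ∀ o → LeO o (inj₁ tt)
  LeO-top (inj₁ _) = _
  LeO-top (inj₂ _) = _

  -- If ⟦ {x} ⟧₂ ⊑′ ⟦ {y} ⟧₂ then x converges wherever y does (else ⊤ would
  -- lie below a family), and A(x,w) ⊂⊂ ⟦{x}⟧₂ w ⊂⊂ ⟦{y}⟧₂ w ⊂⊂ A(y,w).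
  ⊑′⇒must : ∀ x y → ⟦ ｛ x ｝ ⟧₂ ⊑′ ⟦ ｛ y ｝ ⟧₂ → y ⊑must x
  ⊑′⇒must x y x⊑′y w y↓w with singleton-denotation w y↓w
  ... | Fy , ⟦y⟧≡Fy , Fy⊂⊂Accy , _ = x↓w , ⊂⊂-trans Accx⊂⊂Fx (⊂⊂-trans Fx⊂⊂Fy Fy⊂⊂Accy)
    where
      x↓w : x ↓ w
      x↓w = stable λ ¬x↓w → lower (subst₂ LeO (divergent-top w _ x refl ¬x↓w) ⟦y⟧≡Fy (x⊑′y w))
      Gx = singleton-denotation w x↓w
      Accx⊂⊂Fx = proj₂ (proj₂ (proj₂ Gx))
      Fx⊂⊂Fy : proj₁ Gx ⊂⊂ Fy
      Fx⊂⊂Fy = subst₂ LeO (proj₁ (proj₂ Gx)) ⟦y⟧≡Fy (x⊑′y w)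

  -- Conversely: where y diverges the right side is ⊤; elsewhere x converges
  -- too and ⟦{x}⟧₂ w ⊂⊂ A(x,w) ⊂⊂ A(y,w) ⊂⊂ ⟦{y}⟧₂ w.
  must⇒⊑′ : ∀ x y → y ⊑must x → ⟦ ｛ x ｝ ⟧₂ ⊑′ ⟦ ｛ y ｝ ⟧₂
  must⇒⊑′ x y y⊑x w with decide (y ↓ w)
  ... | inj₂ ¬y↓w = subst (LeO _) (sym (divergent-top w _ y refl ¬y↓w)) (LeO-top _)
  ... | inj₁ y↓w with y⊑x w y↓w
  ...   | x↓w , Accx⊂⊂Accy with singleton-denotation w x↓w | singleton-denotation w y↓w
  ...     | Fx , ⟦x⟧≡Fx , Fx⊂⊂Accx , _ | Fy , ⟦y⟧≡Fy , _ , Accy⊂⊂Fy =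
    subst₂ LeO (sym ⟦x⟧≡Fx) (sym ⟦y⟧≡Fy) (⊂⊂-trans Fx⊂⊂Accx (⊂⊂-trans Accx⊂⊂Accy Accy⊂⊂Fy))

proposition4p4 : (em : ExcludedMiddle 0ℓ) (L : LTS) → FinitelyBranching L →
    (x y : LTS.S L) →
    (Semantics._⊑′_ em L (Semantics.⟦_⟧₂ em L (Semantics.｛_｝ em L x)) (Semantics.⟦_⟧₂ em L (Semantics.｛_｝ em L y)))
    ⇔ Semantics._⊑must_ em L y x
proposition4p4 em L fb x y = mk⇔ (⊑′⇒must x y) (must⇒⊑′ x y)
  where open Proof em L fb
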